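{- Let $n\ge 2$. Then $\Theta_1(\Gamma_n)\cup\Theta_n(\Gamma_n)$ is a maximal (with respect to inclusion) edge general position set of $\Gamma_n$. Moreover, ${\rm gp_e}(\Gamma_n)\ge 2F_n$.
   Context: Fibonacci numbers: $F_0=0$, $F_1=1$, $F_{m+2}=F_{m+1}+F_m$. The Fibonacci cube $\Gamma_n$ is the graph whose vertices are the binary strings of length $n$ with no two consecutive 1s, two vertices being adjacent iff they differ in exactly one coordinate. For $i\in\{1,\ldots,n\}$, $\Theta_i(\Gamma_n)$ is the set of edges of $\Gamma_n$ whose endpoints differ in coordinate $i$. A set of edges $X\subseteq E(G)$ is an edge general position set of a graph $G$ if no three edges of $X$ lie on a common shortest path of $G$; ${\rm gp_e}(G)$ is the maximum cardinality of an edge general position set of $G$. -}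

module Defs where

open import Data.Nat using (ℕ; zero; suc; _+_; _*_; _≤_)
open import Data.Bool using (Bool; true; false)
open import Data.Vec using (Vec; []; _∷_; lookup)
open import Data.Fin using (Fin)
open import Data.Product using (Σ; _×_; _,_; proj₁)
open import Data.Sum using (_⊎_)
open import Data.Unit using (⊤)
open import Data.Empty using (⊥)
open import Data.List using (List; length)
open import Data.List.Relation.Unary.Any using (Any)
open import Data.List.Relation.Unary.AllPairs using (AllPairs)
open import Relation.Nullary using (¬_)
open import Relation.Binary.PropositionalEquality using (_≡_; _≢_)

fib : ℕ → ℕ
fib zero = 0
fib (suc zero) = 1
fib (suc (suc m)) = fib (suc m) + fib m

-- binary strings with no two consecutive 1s (true = 1)
NoCons : ∀ {n} → Vec Bool n → Set
NoCons [] = ⊤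
NoCons (x ∷ []) = ⊤
NoCons (x ∷ y ∷ xs) = (x ≡ true → y ≡ true → ⊥) × NoCons (y ∷ xs)

-- vertices of the Fibonacci cube Γ_n
Vertex : ℕ → Set
Vertex n = Σ (Vec Bool n) NoCons

-- u and v differ in coordinate i (coordinates 1..n are Fin n = 0..n-1)
DiffAt : ∀ {n} → Vertex n → Vertex n → Fin n → Set
DiffAt u v i = lookup (proj₁ u) i ≢ lookup (proj₁ v) i

Adj : ∀ {n} → Vertex n → Vertex n → Set
Adj {n} u v = Σ (Fin n) λ i → DiffAt u v i × (∀ (j : Fin n) → DiffAt u v j → j ≡ i)

_≈V_ : ∀ {n} → Vertex n → Vertex n → Set
u ≈V v = proj₁ u ≡ proj₁ v

data Walk {n : ℕ} : Vertex n → Vertex n → Set where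
  stop : ∀ {u} → Walk u u
  step : ∀ {u v w} → Adj u v → Walk v w → Walk u w

walkLength : ∀ {n} {u v : Vertex n} → Walk u v → ℕ
walkLength stop = 0
walkLength (step _ w) = suc (walkLength w)

Geodesic : ∀ {n} {u v : Vertex n} → Walk u v → Set
Geodesic {n} {u} {v} w = ∀ (w' : Walk u v) → walkLength w ≤ walkLength w'

-- (oriented representatives of) edges of Γ_n
record Edge (n : ℕ) : Set where
  constructor edge
  field
    end₁ : Vertex n
    end₂ : Vertex n
    adj  : Adj end₁ end₂
open Edge public

SameEdge : ∀ {n} → Edge n → Edge n → Set
SameEdge e f = ((end₁ e ≈V end₁ f) × (end₂ e ≈V end₂ f))
             ⊎ ((end₁ e ≈V end₂ f) × (end₂ e ≈V end₁ f))

data OnWalk {n : ℕ} (e : Edge n) : {u v : Vertex n} → Walk u v → Set where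
  here  : ∀ {u v w} (a : Adj u v) (p : Walk v w) →
          SameEdge e (edge u v a) → OnWalk e {u} {w} (step {u = u} {v = v} a p)
  there : ∀ {u v w} (a : Adj u v) (p : Walk v w) →
          OnWalk e {v} {w} p → OnWalk e {u} {w} (step {u = u} {v = v} a p)

EdgeSet : ℕ → Set₁
EdgeSet n = Edge n → Set

IsEdgeGP : ∀ {n} → EdgeSet n → Set
IsEdgeGP {n} X = ∀ (e₁ e₂ e₃ : Edge n) → X e₁ → X e₂ → X e₃ →
  ¬ SameEdge e₁ e₂ → ¬ SameEdge e₁ e₃ → ¬ SameEdge e₂ e₃ →
  ∀ {u v : Vertex n} (w : Walk u v) → Geodesic w →
  ¬ (OnWalk e₁ w × OnWalk e₂ w × OnWalk e₃ w)

insertEdge : ∀ {n} → EdgeSet n → Edge n → EdgeSet n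
insertEdge X e f = X f ⊎ SameEdge f e

IsMaximalEdgeGP : ∀ {n} → EdgeSet n → Set
IsMaximalEdgeGP {n} X = IsEdgeGP X × (∀ (e : Edge n) → ¬ X e → ¬ IsEdgeGP (insertEdge X e))

Θ : ∀ {n} → Fin n → EdgeSet n
Θ i e = DiffAt (end₁ e) (end₂ e) i

_∪E_ : ∀ {n} → EdgeSet n → EdgeSet n → EdgeSet n
(X ∪E Y) e = X e ⊎ Y e

GpeAtLeast : (n k : ℕ) → Set
GpeAtLeast n k = Σ (List (Edge n)) λ es →
  length es ≡ k × AllPairs (λ e f → ¬ SameEdge e f) es ×
  IsEdgeGP (λ e → Any (SameEdge e) es)

-- A walk that crosses two distinct edges of one class Θ_i is at least 2 longer
-- than the Hamming distance of its ends, while Γ_n is isometric in the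
-- hypercube. So a shortest path meets each Θ_i at most once, and no three edges
-- of Θ_1 ∪ Θ_n lie on one. For e ∈ Θ_k with 1 < k < n, let x be the endpoint
-- of e with x_k = 0 and s = x̄_1 0 ⋯ 0 x̄_n: a shortest path from s to x,
-- followed by e, is a shortest path through an edge of Θ_1, an edge of Θ_n
-- and e. Finally Θ_1 and Θ_n have F_n edges each, indexed by Γ_{n-2}.
module Submission where

open import Defs
open import Data.Nat using (ℕ; suc; _*_)
open import Data.Fin using (zero; fromℕ)
open import Data.Product using (_×_)

open import Data.Bool using (Bool; true; false; not)
import Data.Bool.Properties as Bool
open import Data.Bool.Properties using (not-¬; ¬-not; not-involutive)
open import Data.Empty using (⊥-elim)
open import Data.Fin using (Fin; suc)
open import Data.Fin.Properties using (_≟_)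
open import Data.List using (List; []; _∷_; map; _++_; length)
open import Data.List.Properties using (length-map; length-++)
open import Data.List.Relation.Unary.All using (All; []; _∷_; universal; lookupAny)
import Data.List.Relation.Unary.All.Properties as All
open import Data.List.Relation.Unary.AllPairs using (AllPairs; []; _∷_)
import Data.List.Relation.Unary.AllPairs as AllPairs
import Data.List.Relation.Unary.AllPairs.Properties as AllPairs
open import Data.List.Relation.Unary.Any using (Any)
import Data.List.Relation.Unary.Any as Any
open import Data.Nat using (zero; _+_; _≤_; z≤n; s≤s)
open import Data.Nat.Properties
  using (module ≤-Reasoning; ≤-refl; ≤-trans; ≤-reflexive; +-mono-≤; +-suc; +-comm; +-identityʳ;
         n≤1+n; 1+n≰n; +-commutativeSemigroup)
open import Algebra.Properties.CommutativeSemigroup +-commutativeSemigroup using (interchange)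
open import Data.Product using (Σ; _,_; proj₁; proj₂)
open import Data.Sum using (inj₁; inj₂)
import Data.Sum as Sum
open import Data.Unit using (tt)
open import Data.Vec using (Vec; []; _∷_; lookup; updateAt)
open import Data.Vec.Properties
  using (∷-injectiveˡ; ∷-injectiveʳ; lookup∘updateAt; lookup∘updateAt′;
         updateAt-updateAt; updateAt-cong; updateAt-id; tabulate∘lookup; tabulate-cong)
open import Function using (_∘_)
open import Relation.Binary.PropositionalEquality
open import Relation.Nullary using (¬_; yes; no)
open import Relation.Nullary.Decidable using (decidable-stable)

bitDistance : Bool → Bool → ℕ
bitDistance false false = 0
bitDistance true  true  = 0
bitDistance _     _     = 1

hamming : ∀ {n} → Vec Bool n → Vec Bool n → ℕ
hamming []      []      = 0
hamming (a ∷ x) (b ∷ y) = bitDistance a b + hamming x y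

flipAt : ∀ {n} → Vec Bool n → Fin n → Vec Bool n
flipAt x i = updateAt x i not

lookup-ext : ∀ {n} {x y : Vec Bool n} → (∀ j → lookup x j ≡ lookup y j) → x ≡ y
lookup-ext {x = x} {y} x≗y =
  trans (sym (tabulate∘lookup x)) (trans (tabulate-cong x≗y) (tabulate∘lookup y))

flipAt-involutive : ∀ {n} (x : Vec Bool n) (i : Fin n) → flipAt (flipAt x i) i ≡ x
flipAt-involutive x i =
  trans (updateAt-updateAt i x) (trans (updateAt-cong i not-involutive x) (updateAt-id i x))

hamming-refl : ∀ {n} (x : Vec Bool n) → hamming x x ≡ 0
hamming-refl []          = refl
hamming-refl (false ∷ x) = hamming-refl x
hamming-refl (true  ∷ x) = hamming-refl x

bitDistance-triangle : ∀ a b c → bitDistance a c ≤ bitDistance a b + bitDistance b c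
bitDistance-triangle false false c     = ≤-refl
bitDistance-triangle true  true  c     = ≤-refl
bitDistance-triangle false true  false = z≤n
bitDistance-triangle false true  true  = s≤s z≤n
bitDistance-triangle true  false false = s≤s z≤n
bitDistance-triangle true  false true  = z≤n

hamming-triangle : ∀ {n} (x y z : Vec Bool n) → hamming x z ≤ hamming x y + hamming y z
hamming-triangle []      []      []      = z≤n
hamming-triangle (a ∷ x) (b ∷ y) (c ∷ z) =
  ≤-trans (+-mono-≤ (bitDistance-triangle a b c) (hamming-triangle x y z))
          (≤-reflexive (interchange (bitDistance a b) (bitDistance b c) (hamming x y) (hamming y z)))

hamming-≤-suc : ∀ {n} (x y z : Vec Bool n) → hamming x y ≡ 1 → hamming x z ≤ suc (hamming y z)
hamming-≤-suc x y z xy≡1 = ≤-trans (hamming-triangle x y z) (≤-reflexive (cong (_+ hamming y z) xy≡1))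

hamming-flipAt-agree : ∀ {n} (s x : Vec Bool n) (i : Fin n) → lookup s i ≡ lookup x i →
  hamming s (flipAt x i) ≡ suc (hamming s x)
hamming-flipAt-agree (false ∷ s) (.false ∷ x) zero    refl = refl
hamming-flipAt-agree (true  ∷ s) (.true  ∷ x) zero    refl = refl
hamming-flipAt-agree (a     ∷ s) (b      ∷ x) (suc i) sᵢ≡xᵢ =
  trans (cong (bitDistance a b +_) (hamming-flipAt-agree s x i sᵢ≡xᵢ))
        (+-suc (bitDistance a b) (hamming s x))

hamming-flipAt : ∀ {n} (x : Vec Bool n) (i : Fin n) → hamming x (flipAt x i) ≡ 1
hamming-flipAt x i = trans (hamming-flipAt-agree x x i refl) (cong suc (hamming-refl x))

bitDistance-not : ∀ a b → bitDistance (not a) (not b) ≡ bitDistance a b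
bitDistance-not false false = refl
bitDistance-not false true  = refl
bitDistance-not true  false = refl
bitDistance-not true  true  = refl

hamming-flipAt-flipAt : ∀ {n} (x y : Vec Bool n) (i : Fin n) →
  hamming (flipAt x i) (flipAt y i) ≡ hamming x y
hamming-flipAt-flipAt (a ∷ x) (b ∷ y) zero    = cong (_+ hamming x y) (bitDistance-not a b)
hamming-flipAt-flipAt (a ∷ x) (b ∷ y) (suc i) = cong (bitDistance a b +_) (hamming-flipAt-flipAt x y i)

flipAt⇒Adj : ∀ {n} (u v : Vertex n) (i : Fin n) → proj₁ v ≡ flipAt (proj₁ u) i → Adj u v
flipAt⇒Adj (x , _) (_ , _) i refl = i , flips , onlyAt
  where
  flips : lookup x i ≢ lookup (flipAt x i) i
  flips xᵢ≡ = not-¬ refl (trans xᵢ≡ (lookup∘updateAt i x))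
  onlyAt : ∀ j → lookup x j ≢ lookup (flipAt x i) j → j ≡ i
  onlyAt j xⱼ≢ with j ≟ i
  ... | yes j≡i = j≡i
  ... | no  j≢i = ⊥-elim (xⱼ≢ (sym (lookup∘updateAt′ j i j≢i x)))

Adj⇒flipAt : ∀ {n} (u v : Vertex n) (a : Adj u v) → proj₁ v ≡ flipAt (proj₁ u) (proj₁ a)
Adj⇒flipAt (x , _) (y , _) (i , xᵢ≢yᵢ , onlyAt) = lookup-ext agree
  where
  agree : ∀ j → lookup y j ≡ lookup (flipAt x i) j
  agree j with j ≟ i
  ... | yes refl = trans (¬-not (xᵢ≢yᵢ ∘ sym)) (sym (lookup∘updateAt i x))
  ... | no  j≢i  =
    trans (decidable-stable (lookup y j Bool.≟ lookup x j) (λ yⱼ≢xⱼ → j≢i (onlyAt j (yⱼ≢xⱼ ∘ sym))))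
          (sym (lookup∘updateAt′ j i j≢i x))

Adj-sym : ∀ {n} (u v : Vertex n) → Adj u v → Adj v u
Adj-sym _ _ (i , uᵢ≢vᵢ , onlyAt) = i , uᵢ≢vᵢ ∘ sym , λ j vⱼ≢uⱼ → onlyAt j (vⱼ≢uⱼ ∘ sym)

hamming-edge : ∀ {n} (e : Edge n) → hamming (proj₁ (end₁ e)) (proj₁ (end₂ e)) ≡ 1
hamming-edge (edge u v a) =
  trans (cong (hamming (proj₁ u)) (Adj⇒flipAt u v a)) (hamming-flipAt (proj₁ u) (proj₁ a))

SameEdge-sym : ∀ {n} (e f : Edge n) → SameEdge e f → SameEdge f e
SameEdge-sym _ _ (inj₁ (p , q)) = inj₁ (sym p , sym q)
SameEdge-sym _ _ (inj₂ (p , q)) = inj₂ (sym q , sym p)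

SameEdge-trans : ∀ {n} (e f g : Edge n) → SameEdge e f → SameEdge f g → SameEdge e g
SameEdge-trans _ _ _ (inj₁ (p , q)) (inj₁ (p′ , q′)) = inj₁ (trans p p′ , trans q q′)
SameEdge-trans _ _ _ (inj₁ (p , q)) (inj₂ (p′ , q′)) = inj₂ (trans p p′ , trans q q′)
SameEdge-trans _ _ _ (inj₂ (p , q)) (inj₁ (p′ , q′)) = inj₂ (trans p q′ , trans q p′)
SameEdge-trans _ _ _ (inj₂ (p , q)) (inj₂ (p′ , q′)) = inj₁ (trans p q′ , trans q p′)

SameEdge-shared : ∀ {n} (e f g : Edge n) → SameEdge e g → SameEdge f g → SameEdge e f
SameEdge-shared e f g e≈g f≈g = SameEdge-trans e g f e≈g (SameEdge-sym f g f≈g)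

Θ-resp-SameEdge : ∀ {n} (i : Fin n) (e f : Edge n) → SameEdge e f → Θ i e → Θ i f
Θ-resp-SameEdge i _ _ (inj₁ (p , q)) θ = subst₂ (λ x y → lookup x i ≢ lookup y i) p q θ
Θ-resp-SameEdge i _ _ (inj₂ (p , q)) θ = subst₂ (λ x y → lookup x i ≢ lookup y i) p q θ ∘ sym

Θ-unique : ∀ {n} (e : Edge n) (i j : Fin n) → Θ i e → Θ j e → i ≡ j
Θ-unique e i j θᵢ θⱼ = trans (onlyAt i θᵢ) (sym (onlyAt j θⱼ))
  where onlyAt = proj₂ (proj₂ (adj e))

Θ-disjoint : ∀ {n} {i j : Fin n} (e f : Edge n) → i ≢ j → Θ i e → Θ j f → ¬ SameEdge e f
Θ-disjoint {i = i} {j} e f i≢j θe θf e≈f = i≢j (Θ-unique f i j (Θ-resp-SameEdge i e f e≈f θe) θf)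

Θ⇒flipAt : ∀ {n} (e : Edge n) (i : Fin n) → Θ i e → proj₁ (end₂ e) ≡ flipAt (proj₁ (end₁ e)) i
Θ⇒flipAt (edge u v a) i θ =
  subst (λ k → proj₁ v ≡ flipAt (proj₁ u) k) (sym (proj₂ (proj₂ a) i θ)) (Adj⇒flipAt u v a)

_++ʷ_ : ∀ {n} {u v w : Vertex n} → Walk u v → Walk v w → Walk u w
stop     ++ʷ q = q
step a p ++ʷ q = step a (p ++ʷ q)

walkLength-++ : ∀ {n} {u v w : Vertex n} (p : Walk u v) (q : Walk v w) →
  walkLength (p ++ʷ q) ≡ walkLength p + walkLength q
walkLength-++ stop       q = refl
walkLength-++ (step a p) q = cong suc (walkLength-++ p q)

OnWalk-++ˡ : ∀ {n} {e : Edge n} {u v w : Vertex n} (p : Walk u v) (q : Walk v w) →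
  OnWalk e p → OnWalk e (p ++ʷ q)
OnWalk-++ˡ (step a p) q (here  _ _ e≈) = here a (p ++ʷ q) e≈
OnWalk-++ˡ (step a p) q (there _ _ on) = there a (p ++ʷ q) (OnWalk-++ˡ p q on)

OnWalk-++ʳ : ∀ {n} {e : Edge n} {u v w : Vertex n} (p : Walk u v) (q : Walk v w) →
  OnWalk e q → OnWalk e (p ++ʷ q)
OnWalk-++ʳ stop       q on = on
OnWalk-++ʳ (step a p) q on = there a (p ++ʷ q) (OnWalk-++ʳ p q on)

Θ-edge-on-walk : ∀ {n} (i : Fin n) {u v : Vertex n} (w : Walk u v) →
  lookup (proj₁ u) i ≢ lookup (proj₁ v) i → Σ (Edge n) λ e → Θ i e × OnWalk e w
Θ-edge-on-walk i stop uᵢ≢vᵢ = ⊥-elim (uᵢ≢vᵢ refl)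
Θ-edge-on-walk i {u} (step {v = z} a p) uᵢ≢vᵢ with lookup (proj₁ u) i Bool.≟ lookup (proj₁ z) i
... | no  uᵢ≢zᵢ = edge u z a , uᵢ≢zᵢ , here a p (inj₁ (refl , refl))
... | yes uᵢ≡zᵢ =
  let e , θ , on = Θ-edge-on-walk i p (uᵢ≢vᵢ ∘ trans uᵢ≡zᵢ) in e , θ , there a p on

hamming≤walkLength : ∀ {n} {u v : Vertex n} (w : Walk u v) →
  hamming (proj₁ u) (proj₁ v) ≤ walkLength w
hamming≤walkLength {u = u} stop = ≤-reflexive (hamming-refl (proj₁ u))
hamming≤walkLength {u = u} {v} (step {v = z} a p) =
  ≤-trans (hamming-≤-suc (proj₁ u) (proj₁ z) (proj₁ v) (hamming-edge (edge u z a)))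
          (s≤s (hamming≤walkLength p))

walkLength-through-Θ : ∀ {n} {i : Fin n} (e : Edge n) → Θ i e → {u v : Vertex n} (w : Walk u v) →
  OnWalk e w → suc (hamming (flipAt (proj₁ u) i) (proj₁ v)) ≤ walkLength w
walkLength-through-Θ {i = i} e θ {u} {v} (step {v = z} a p) (here _ _ e≈) =
  s≤s (subst (λ y → hamming y (proj₁ v) ≤ walkLength p)
             (Θ⇒flipAt (edge u z a) i (Θ-resp-SameEdge i e (edge u z a) e≈ θ)) (hamming≤walkLength p))
walkLength-through-Θ {i = i} e θ {u} {v} (step {v = z} a p) (there _ _ on) =
  s≤s (≤-trans (hamming-≤-suc (flipAt (proj₁ u) i) (flipAt (proj₁ z) i) (proj₁ v)
                  (trans (hamming-flipAt-flipAt (proj₁ u) (proj₁ z) i) (hamming-edge (edge u z a))))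
               (walkLength-through-Θ e θ p on))

-- Crossing Θ_i again undoes the first crossing.
walkLength-Θ-step-then-Θ : ∀ {n} {i : Fin n} (g h : Edge n) {u z v : Vertex n} (a : Adj u z) (p : Walk z v) →
  Θ i g → SameEdge g (edge u z a) → Θ i h → OnWalk h p →
  2 + hamming (proj₁ u) (proj₁ v) ≤ suc (walkLength p)
walkLength-Θ-step-then-Θ {i = i} g h {u} {z} {v} a p θg g≈ θh onh =
  s≤s (subst (λ y → suc (hamming y (proj₁ v)) ≤ walkLength p)
             (trans (cong (λ y → flipAt y i)
                          (Θ⇒flipAt (edge u z a) i (Θ-resp-SameEdge i g (edge u z a) g≈ θg)))
                    (flipAt-involutive (proj₁ u) i))
             (walkLength-through-Θ h θh p onh))

walkLength-through-two-Θ : ∀ {n} {i : Fin n} (e f : Edge n) → Θ i e → Θ i f → ¬ SameEdge e f →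
  {u v : Vertex n} (w : Walk u v) → OnWalk e w → OnWalk f w →
  2 + hamming (proj₁ u) (proj₁ v) ≤ walkLength w
walkLength-through-two-Θ e f θe θf e≉f (step {u} {z} a p) (here _ _ e≈) (here _ _ f≈) =
  ⊥-elim (e≉f (SameEdge-shared e f (edge u z a) e≈ f≈))
walkLength-through-two-Θ {i = i} e f θe θf e≉f {v = v} (step {u} {z} a p) (here _ _ e≈) (there _ _ onf) =
  walkLength-Θ-step-then-Θ {i = i} e f {u} {z} {v} a p θe e≈ θf onf
walkLength-through-two-Θ {i = i} e f θe θf e≉f {v = v} (step {u} {z} a p) (there _ _ one) (here _ _ f≈) =
  walkLength-Θ-step-then-Θ {i = i} f e {u} {z} {v} a p θf f≈ θe one
walkLength-through-two-Θ e f θe θf e≉f {u} {v} (step {v = z} a p) (there _ _ one) (there _ _ onf) =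
  s≤s (≤-trans (s≤s (hamming-≤-suc (proj₁ u) (proj₁ z) (proj₁ v) (hamming-edge (edge u z a))))
               (walkLength-through-two-Θ e f θe θf e≉f p one onf))

walkLength-through-edge : ∀ {n} {e : Edge n} {u v : Vertex n} (w : Walk u v) →
  OnWalk e w → 1 ≤ walkLength w
walkLength-through-edge (step a p) _ = s≤s z≤n

walkLength-through-two-edges : ∀ {n} (e f : Edge n) → ¬ SameEdge e f →
  {u v : Vertex n} (w : Walk u v) → OnWalk e w → OnWalk f w → 2 ≤ walkLength w
walkLength-through-two-edges e f e≉f (step {u} {z} a p) (here _ _ e≈) (here _ _ f≈) =
  ⊥-elim (e≉f (SameEdge-shared e f (edge u z a) e≈ f≈))
walkLength-through-two-edges e f e≉f (step a p) (here _ _ _) (there _ _ onf) =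
  s≤s (walkLength-through-edge p onf)
walkLength-through-two-edges e f e≉f (step a p) (there _ _ one) (here _ _ _) =
  s≤s (walkLength-through-edge p one)
walkLength-through-two-edges e f e≉f (step a p) (there _ _ one) (there _ _ onf) =
  ≤-trans (walkLength-through-two-edges e f e≉f p one onf) (n≤1+n _)

walkLength-through-three-edges : ∀ {n} (e f g : Edge n) →
  ¬ SameEdge e f → ¬ SameEdge e g → ¬ SameEdge f g →
  {u v : Vertex n} (w : Walk u v) → OnWalk e w → OnWalk f w → OnWalk g w → 3 ≤ walkLength w
walkLength-through-three-edges e f g e≉f e≉g f≉g (step {u} {z} a p) (here _ _ e≈) (here _ _ f≈) _ =
  ⊥-elim (e≉f (SameEdge-shared e f (edge u z a) e≈ f≈))
walkLength-through-three-edges e f g e≉f e≉g f≉g (step {u} {z} a p) (here _ _ e≈) _ (here _ _ g≈) =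
  ⊥-elim (e≉g (SameEdge-shared e g (edge u z a) e≈ g≈))
walkLength-through-three-edges e f g e≉f e≉g f≉g (step {u} {z} a p) _ (here _ _ f≈) (here _ _ g≈) =
  ⊥-elim (f≉g (SameEdge-shared f g (edge u z a) f≈ g≈))
walkLength-through-three-edges e f g e≉f e≉g f≉g (step a p) (here _ _ _) (there _ _ onf) (there _ _ ong) =
  s≤s (walkLength-through-two-edges f g f≉g p onf ong)
walkLength-through-three-edges e f g e≉f e≉g f≉g (step a p) (there _ _ one) (here _ _ _) (there _ _ ong) =
  s≤s (walkLength-through-two-edges e g e≉g p one ong)
walkLength-through-three-edges e f g e≉f e≉g f≉g (step a p) (there _ _ one) (there _ _ onf) (here _ _ _) =
  s≤s (walkLength-through-two-edges e f e≉f p one onf)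
walkLength-through-three-edges e f g e≉f e≉g f≉g (step a p) (there _ _ one) (there _ _ onf) (there _ _ ong) =
  ≤-trans (walkLength-through-three-edges e f g e≉f e≉g f≉g p one onf ong) (n≤1+n _)

-- Γ_n is isometric in the hypercube

NoCons-tail : ∀ {n} {a : Bool} {x : Vec Bool n} → NoCons (a ∷ x) → NoCons x
NoCons-tail {x = []}    _       = tt
NoCons-tail {x = _ ∷ _} (_ , p) = p

NoCons-0∷ : ∀ {n} {x : Vec Bool n} → NoCons x → NoCons (false ∷ x)
NoCons-0∷ {x = []}    _ = tt
NoCons-0∷ {x = _ ∷ _} p = (λ ()) , p

NoCons-10∷ : ∀ {n} {x : Vec Bool n} → NoCons x → NoCons (true ∷ false ∷ x)
NoCons-10∷ p = (λ _ ()) , NoCons-0∷ p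

-- NoCons certificates are functions, so two vertices with the same string need
-- not be equal; the certificates at the ends of these walks are left free.
HammingWalk : ∀ {n} → Vec Bool n → Vec Bool n → Set
HammingWalk x y =
  Σ (NoCons x) λ px → Σ (NoCons y) λ py → Σ (Walk (x , px) (y , py)) λ w → walkLength w ≡ hamming x y

module _ {m n} (f : Vec Bool m → Vec Bool n) (f-NoCons : ∀ {x} → NoCons x → NoCons (f x))
  (f-Adj : ∀ {x y} (px : NoCons x) (py : NoCons y) → Adj (x , px) (y , py) →
           Adj (f x , f-NoCons px) (f y , f-NoCons py))
  (f-hamming : ∀ x y → hamming (f x) (f y) ≡ hamming x y)
  where

  mapWalk : ∀ {x y} {px : NoCons x} {py : NoCons y} →
    Walk (x , px) (y , py) → Walk (f x , f-NoCons px) (f y , f-NoCons py)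
  mapWalk stop = stop
  mapWalk {px = px} (step {v = _ , pz} a p) = step (f-Adj px pz a) (mapWalk p)

  walkLength-mapWalk : ∀ {x y} {px : NoCons x} {py : NoCons y} (w : Walk (x , px) (y , py)) →
    walkLength (mapWalk w) ≡ walkLength w
  walkLength-mapWalk stop = refl
  walkLength-mapWalk (step {v = _ , _} a p) = cong suc (walkLength-mapWalk p)

  mapHammingWalk : ∀ {x y} → HammingWalk x y → HammingWalk (f x) (f y)
  mapHammingWalk {x} {y} (px , py , w , ℓ) =
    f-NoCons px , f-NoCons py , mapWalk w , trans (walkLength-mapWalk w) (trans ℓ (sym (f-hamming x y)))

prepend0 : ∀ {n} {x y : Vec Bool n} → HammingWalk x y → HammingWalk (false ∷ x) (false ∷ y)
prepend0 = mapHammingWalk (false ∷_) NoCons-0∷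
  (λ px py a → flipAt⇒Adj (_ , NoCons-0∷ px) (_ , NoCons-0∷ py) (suc (proj₁ a))
                          (cong (false ∷_) (Adj⇒flipAt (_ , px) (_ , py) a)))
  (λ _ _ → refl)

prepend10 : ∀ {n} {x y : Vec Bool n} → HammingWalk x y → HammingWalk (true ∷ false ∷ x) (true ∷ false ∷ y)
prepend10 = mapHammingWalk (λ z → true ∷ false ∷ z) NoCons-10∷
  (λ px py a → flipAt⇒Adj (_ , NoCons-10∷ px) (_ , NoCons-10∷ py) (suc (suc (proj₁ a)))
                          (cong (λ z → true ∷ false ∷ z) (Adj⇒flipAt (_ , px) (_ , py) a)))
  (λ _ _ → refl)

hammingWalk : ∀ {n} (x y : Vec Bool n) → NoCons x → NoCons y → HammingWalk x y
hammingWalk [] [] _ _ = tt , tt , stop , refl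
hammingWalk (false ∷ x) (false ∷ y) px py = prepend0 (hammingWalk x y (NoCons-tail px) (NoCons-tail py))
hammingWalk (false ∷ x) (true ∷ y) px py =
  let P , Q , w , ℓ = prepend0 (hammingWalk x y (NoCons-tail px) (NoCons-tail py))
  in  P , py , w ++ʷ step (flipAt⇒Adj (false ∷ y , Q) (true ∷ y , py) zero refl) stop ,
      trans (walkLength-++ w _) (trans (+-comm (walkLength w) 1) (cong suc ℓ))
hammingWalk (true ∷ x) (false ∷ y) px py =
  let P , Q , w , ℓ = prepend0 (hammingWalk x y (NoCons-tail px) (NoCons-tail py))
  in  px , Q , step (flipAt⇒Adj (true ∷ x , px) (false ∷ x , P) zero refl) w , cong suc ℓ
hammingWalk (true ∷ []) (true ∷ []) _ _ = tt , tt , stop , refl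
hammingWalk (true ∷ true ∷ x) _ px _ = ⊥-elim (proj₁ px refl refl)
hammingWalk (true ∷ false ∷ x) (true ∷ true ∷ y) _ py = ⊥-elim (proj₁ py refl refl)
hammingWalk (true ∷ false ∷ x) (true ∷ false ∷ y) px py =
  prepend10 (hammingWalk x y (NoCons-tail (NoCons-tail px)) (NoCons-tail (NoCons-tail py)))

-- Adj ignores certificates, so only the empty walk ties the certificates of its ends.
reattach : ∀ {n} {x y : Vec Bool n} {px py : NoCons x} {qx qy : NoCons y} (w : Walk (x , px) (y , qx)) →
  1 ≤ walkLength w → Σ (Walk (x , py) (y , qy)) λ w′ → walkLength w′ ≡ walkLength w
reattach (step a stop) _ = step a stop , refl
reattach (step {v = _ , pz} a w@(step _ _)) _ =
  let w′ , ℓ = reattach {py = pz} w (s≤s z≤n) in step a w′ , cong suc ℓ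

-- General position and maximality of Θ_i ∪ Θ_j

geodesic-length : ∀ {n} {u v : Vertex n} (w : Walk u v) → Geodesic w → 3 ≤ walkLength w →
  walkLength w ≤ hamming (proj₁ u) (proj₁ v)
geodesic-length {u = x , px} {y , py} w geo 3≤ with hammingWalk x y px py
geodesic-length {u = x , px} {.x , py} (step {v = z} a p) geo 3≤ | _ , _ , stop , _ =
  -- u and v carry the same string, and are joined by a detour of length 2
  ⊥-elim (1+n≰n (≤-trans 3≤ (geo (step {v = z} a (step (Adj-sym (x , py) z a) stop)))))
... | _ , _ , h@(step _ _) , ℓ =
  let w′ , ℓ′ = reattach {py = px} {qy = py} h (s≤s z≤n) in ≤-trans (geo w′) (≤-reflexive (trans ℓ′ ℓ))

Θ-∪-isEdgeGP : ∀ {n} (i j : Fin n) → IsEdgeGP (Θ i ∪E Θ j)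
Θ-∪-isEdgeGP i j e₁ e₂ e₃ x₁ x₂ x₃ e₁≉e₂ e₁≉e₃ e₂≉e₃ {u} {v} w geo (on₁ , on₂ , on₃) =
  1+n≰n (≤-trans (n≤1+n _) (≤-trans (pigeonhole x₁ x₂ x₃) (geodesic-length w geo three)))
  where
  three : 3 ≤ walkLength w
  three = walkLength-through-three-edges e₁ e₂ e₃ e₁≉e₂ e₁≉e₃ e₂≉e₃ w on₁ on₂ on₃
  pigeonhole : (Θ i ∪E Θ j) e₁ → (Θ i ∪E Θ j) e₂ → (Θ i ∪E Θ j) e₃ →
    2 + hamming (proj₁ u) (proj₁ v) ≤ walkLength w
  pigeonhole (inj₁ θ₁) (inj₁ θ₂) _         = walkLength-through-two-Θ {i = i} e₁ e₂ θ₁ θ₂ e₁≉e₂ w on₁ on₂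
  pigeonhole (inj₂ θ₁) (inj₂ θ₂) _         = walkLength-through-two-Θ {i = j} e₁ e₂ θ₁ θ₂ e₁≉e₂ w on₁ on₂
  pigeonhole (inj₁ θ₁) (inj₂ _)  (inj₁ θ₃) = walkLength-through-two-Θ {i = i} e₁ e₃ θ₁ θ₃ e₁≉e₃ w on₁ on₃
  pigeonhole (inj₂ θ₁) (inj₁ _)  (inj₂ θ₃) = walkLength-through-two-Θ {i = j} e₁ e₃ θ₁ θ₃ e₁≉e₃ w on₁ on₃
  pigeonhole (inj₁ _)  (inj₂ θ₂) (inj₂ θ₃) = walkLength-through-two-Θ {i = j} e₂ e₃ θ₂ θ₃ e₂≉e₃ w on₂ on₃
  pigeonhole (inj₂ _)  (inj₁ θ₂) (inj₁ θ₃) = walkLength-through-two-Θ {i = i} e₂ e₃ θ₂ θ₃ e₂≉e₃ w on₂ on₃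

Θ-∪-insert-not-GP : ∀ {n} {i j : Fin n} → i ≢ j → (e : Edge n) → ¬ Θ i e → ¬ Θ j e →
  (x x′ : Vertex n) (a : Adj x x′) → SameEdge e (edge x x′ a) →
  (s : Vertex n) → lookup (proj₁ s) (proj₁ a) ≡ lookup (proj₁ x) (proj₁ a) →
  lookup (proj₁ s) i ≢ lookup (proj₁ x) i → lookup (proj₁ s) j ≢ lookup (proj₁ x) j →
  ¬ IsEdgeGP (insertEdge (Θ i ∪E Θ j) e)
Θ-∪-insert-not-GP {i = i} {j} i≢j e e∉Θᵢ e∉Θⱼ x x′ a e≈ (s , ps) sₖ≡xₖ sᵢ≢xᵢ sⱼ≢xⱼ gp
  with hammingWalk s (proj₁ x) ps (proj₂ x)
... | P , Q , w , ℓ with Θ-edge-on-walk i w sᵢ≢xᵢ | Θ-edge-on-walk j w sⱼ≢xⱼ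
...   | f , θf , onf | g , θg , ong =
  gp f g e (inj₁ (inj₁ θf)) (inj₁ (inj₂ θg)) (inj₂ (inj₁ (refl , refl)))
     (Θ-disjoint f g i≢j θf θg) (λ f≈e → e∉Θᵢ (Θ-resp-SameEdge i f e f≈e θf))
     (λ g≈e → e∉Θⱼ (Θ-resp-SameEdge j g e g≈e θg))
     W geodesic (OnWalk-++ˡ w lastStep onf , OnWalk-++ˡ w lastStep ong ,
                 OnWalk-++ʳ w lastStep (here a stop e≈))
  where
  lastStep : Walk (proj₁ x , Q) x′
  lastStep = step {v = x′} a stop
  W : Walk (s , P) x′
  W = w ++ʷ lastStep
  geodesic : Geodesic W
  geodesic w′ = begin
    walkLength W                             ≡⟨ walkLength-++ w lastStep ⟩
    walkLength w + 1                         ≡⟨ +-comm (walkLength w) 1 ⟩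
    suc (walkLength w)                       ≡⟨ cong suc ℓ ⟩
    suc (hamming s (proj₁ x))                ≡⟨ sym (hamming-flipAt-agree s (proj₁ x) (proj₁ a) sₖ≡xₖ) ⟩
    hamming s (flipAt (proj₁ x) (proj₁ a))   ≡⟨ cong (hamming s) (sym (Adj⇒flipAt x x′ a)) ⟩
    hamming s (proj₁ x′)                     ≤⟨ hamming≤walkLength w′ ⟩
    walkLength w′                            ∎
    where open ≤-Reasoning

zerosThen : ∀ m → Bool → Vec Bool (suc m)
zerosThen zero    b = b ∷ []
zerosThen (suc m) b = false ∷ zerosThen m b

NoCons-zerosThen : ∀ m b → NoCons (zerosThen m b)
NoCons-zerosThen zero    b = tt
NoCons-zerosThen (suc m) b = NoCons-0∷ (NoCons-zerosThen m b)

lookup-zerosThen-last : ∀ m b → lookup (zerosThen m b) (fromℕ m) ≡ b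
lookup-zerosThen-last zero    b = refl
lookup-zerosThen-last (suc m) b = lookup-zerosThen-last m b

lookup-zerosThen-inner : ∀ m b (k : Fin (suc m)) → k ≢ fromℕ m → lookup (zerosThen m b) k ≡ false
lookup-zerosThen-inner zero    b zero    k≢m = ⊥-elim (k≢m refl)
lookup-zerosThen-inner (suc m) b zero    _   = refl
lookup-zerosThen-inner (suc m) b (suc k) k≢m = lookup-zerosThen-inner m b k (k≢m ∘ cong suc)

oppositeEnds : ∀ {m} → Vec Bool (suc (suc (suc m))) → Vertex (suc (suc (suc m)))
oppositeEnds {m} x =
  not (lookup x zero) ∷ false ∷ zerosThen m (not (lookup x (fromℕ (suc (suc m))))) ,
  (λ _ ()) , NoCons-0∷ (NoCons-zerosThen m _)

Θ₁∪Θₙ-insert-not-GP : ∀ m (e : Edge (suc (suc (suc m)))) →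
  ¬ Θ zero e → ¬ Θ (fromℕ (suc (suc m))) e →
  (x x′ : Vertex (suc (suc (suc m)))) (a : Adj x x′) → SameEdge e (edge x x′ a) →
  lookup (proj₁ x) (proj₁ a) ≡ false → ¬ IsEdgeGP (insertEdge (Θ zero ∪E Θ (fromℕ (suc (suc m)))) e)
Θ₁∪Θₙ-insert-not-GP m e e∉Θ₁ e∉Θₙ x x′ a e≈ xₖ≡0 =
  Θ-∪-insert-not-GP (λ ()) e e∉Θ₁ e∉Θₙ x x′ a e≈ (oppositeEnds (proj₁ x))
    (trans (inner (proj₁ a) k≢first k≢last) (sym xₖ≡0))
    (not-¬ refl ∘ sym)
    (not-¬ refl ∘ sym ∘ trans (sym (lookup-zerosThen-last m _)))
  where
  θₖ : ∀ {i} → proj₁ a ≡ i → Θ i e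
  θₖ refl =
    Θ-resp-SameEdge (proj₁ a) (edge x x′ a) e (SameEdge-sym e (edge x x′ a) e≈) (proj₁ (proj₂ a))
  k≢first : proj₁ a ≢ zero
  k≢first = e∉Θ₁ ∘ θₖ
  k≢last : proj₁ a ≢ fromℕ (suc (suc m))
  k≢last = e∉Θₙ ∘ θₖ
  inner : ∀ k → k ≢ zero → k ≢ fromℕ (suc (suc m)) →
    lookup (proj₁ (oppositeEnds (proj₁ x))) k ≡ false
  inner zero          k≢first _      = ⊥-elim (k≢first refl)
  inner (suc zero)    _       _      = refl
  inner (suc (suc k)) _       k≢last = lookup-zerosThen-inner m _ k (k≢last ∘ cong (λ k → suc (suc k)))

Θ₁∪Θₙ-maximal : ∀ m (e : Edge (suc (suc m))) → ¬ (Θ zero ∪E Θ (fromℕ (suc m))) e →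
  ¬ IsEdgeGP (insertEdge (Θ zero ∪E Θ (fromℕ (suc m))) e)
Θ₁∪Θₙ-maximal zero    (edge _ _ (zero     , θ , _)) e∉ = ⊥-elim (e∉ (inj₁ θ))
Θ₁∪Θₙ-maximal zero    (edge _ _ (suc zero , θ , _)) e∉ = ⊥-elim (e∉ (inj₂ θ))
Θ₁∪Θₙ-maximal (suc m) e@(edge u z a) e∉ with lookup (proj₁ u) (proj₁ a) in uₖ
... | false = Θ₁∪Θₙ-insert-not-GP m e (e∉ ∘ inj₁) (e∉ ∘ inj₂) u z a (inj₁ (refl , refl)) uₖ
... | true  = Θ₁∪Θₙ-insert-not-GP m e (e∉ ∘ inj₁) (e∉ ∘ inj₂) z u (Adj-sym u z a) (inj₂ (refl , refl))
                (trans (¬-not (proj₁ (proj₂ a) ∘ sym)) (cong not uₖ))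

-- 2 F_n edges in general position

vertices : ∀ n → List (Vertex n)
vertices zero          = ([] , tt) ∷ []
vertices (suc zero)    = (false ∷ [] , tt) ∷ (true ∷ [] , tt) ∷ []
vertices (suc (suc n)) =
  map (λ (x , px) → false ∷ x , NoCons-0∷ px) (vertices (suc n)) ++
  map (λ (x , px) → true ∷ false ∷ x , NoCons-10∷ px) (vertices n)

length-vertices : ∀ n → length (vertices n) ≡ fib (suc (suc n))
length-vertices zero          = refl
length-vertices (suc zero)    = refl
length-vertices (suc (suc n)) = begin
  length (map _ (vertices (suc n)) ++ map _ (vertices n))
    ≡⟨ length-++ (map _ (vertices (suc n))) ⟩
  length (map _ (vertices (suc n))) + length (map _ (vertices n))
    ≡⟨ cong₂ _+_ (length-map _ (vertices (suc n))) (length-map _ (vertices n)) ⟩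
  length (vertices (suc n)) + length (vertices n)
    ≡⟨ cong₂ _+_ (length-vertices (suc n)) (length-vertices n) ⟩
  fib (suc (suc (suc n))) + fib (suc (suc n))
    ∎
  where open ≡-Reasoning

vertices-distinct : ∀ n → AllPairs (λ u v → proj₁ u ≢ proj₁ v) (vertices n)
vertices-distinct zero          = [] ∷ []
vertices-distinct (suc zero)    = ((λ ()) ∷ []) ∷ [] ∷ []
vertices-distinct (suc (suc n)) = AllPairs.++⁺
  (AllPairs.map⁺ (AllPairs.map (λ x≢y → x≢y ∘ ∷-injectiveʳ) (vertices-distinct (suc n))))
  (AllPairs.map⁺ (AllPairs.map (λ x≢y → x≢y ∘ ∷-injectiveʳ ∘ ∷-injectiveʳ) (vertices-distinct n)))
  (All.map⁺ (universal (λ _ → All.map⁺ (universal (λ _ ()) (vertices n))) (vertices (suc n))))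

append0 : ∀ {m} → Vec Bool m → Bool → Vec Bool (suc (suc m))
append0 []      b = false ∷ b ∷ []
append0 (c ∷ x) b = c ∷ append0 x b

NoCons-append0 : ∀ {m} (x : Vec Bool m) b → NoCons x → NoCons (append0 x b)
NoCons-append0 []          b _ = (λ ()) , tt
NoCons-append0 (c ∷ [])    b _ = (λ _ ()) , (λ ()) , tt
NoCons-append0 (c ∷ d ∷ x) b p = proj₁ p , NoCons-append0 (d ∷ x) b (proj₂ p)

lookup-append0-last : ∀ {m} (x : Vec Bool m) b → lookup (append0 x b) (fromℕ (suc m)) ≡ b
lookup-append0-last []      b = refl
lookup-append0-last (c ∷ x) b = lookup-append0-last x b

flipAt-append0 : ∀ {m} (x : Vec Bool m) → flipAt (append0 x false) (fromℕ (suc m)) ≡ append0 x true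
flipAt-append0 []      = refl
flipAt-append0 (c ∷ x) = cong (c ∷_) (flipAt-append0 x)

append0-injectiveˡ : ∀ {m} (x y : Vec Bool m) {b c} → append0 x b ≡ append0 y c → x ≡ y
append0-injectiveˡ []      []      _  = refl
append0-injectiveˡ (c ∷ x) (d ∷ y) eq =
  cong₂ _∷_ (∷-injectiveˡ eq) (append0-injectiveˡ x y (∷-injectiveʳ eq))

firstEdge : ∀ {m} → Vertex m → Edge (suc (suc m))
firstEdge (x , px) = edge u v (flipAt⇒Adj u v zero refl)
  where
  u v : Vertex _
  u = false ∷ false ∷ x , NoCons-0∷ (NoCons-0∷ px)
  v = true ∷ false ∷ x , NoCons-10∷ px

lastEdge : ∀ {m} → Vertex m → Edge (suc (suc m))
lastEdge {m} (x , px) = edge u v (flipAt⇒Adj u v (fromℕ (suc m)) (sym (flipAt-append0 x)))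
  where
  u v : Vertex _
  u = append0 x false , NoCons-append0 x false px
  v = append0 x true , NoCons-append0 x true px

firstEdge-Θ : ∀ {m} (u : Vertex m) → Θ zero (firstEdge u)
firstEdge-Θ u ()

lastEdge-Θ : ∀ {m} (u : Vertex m) → Θ (fromℕ (suc m)) (lastEdge u)
lastEdge-Θ (x , _) 0≡1
  with trans (sym (lookup-append0-last x false)) (trans 0≡1 (lookup-append0-last x true))
... | ()

firstEdge-distinct : ∀ {m} (u v : Vertex m) → proj₁ u ≢ proj₁ v → ¬ SameEdge (firstEdge u) (firstEdge v)
firstEdge-distinct u v u≢v (inj₁ (same , _)) = u≢v (∷-injectiveʳ (∷-injectiveʳ same))
firstEdge-distinct u v u≢v (inj₂ (() , _))

lastEdge-distinct : ∀ {m} (u v : Vertex m) → proj₁ u ≢ proj₁ v → ¬ SameEdge (lastEdge u) (lastEdge v)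
lastEdge-distinct (x , _) (y , _) x≢y (inj₁ (same , _)) = x≢y (append0-injectiveˡ x y same)
lastEdge-distinct {m} (x , _) (y , _) x≢y (inj₂ (crossed , _))
  with trans (sym (lookup-append0-last x false))
             (trans (cong (λ z → lookup z (fromℕ (suc m))) crossed) (lookup-append0-last y true))
... | ()

∪-resp-SameEdge : ∀ {n} (i j : Fin n) (e f : Edge n) → SameEdge e f → (Θ i ∪E Θ j) e → (Θ i ∪E Θ j) f
∪-resp-SameEdge i j e f e≈f = Sum.map (Θ-resp-SameEdge i e f e≈f) (Θ-resp-SameEdge j e f e≈f)

GpeAtLeast-⊆ : ∀ {n} {X : EdgeSet n} → IsEdgeGP X → (∀ e f → SameEdge e f → X e → X f) →
  (es : List (Edge n)) → AllPairs (λ e f → ¬ SameEdge e f) es → All X es → GpeAtLeast n (length es)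
GpeAtLeast-⊆ {X = X} gp X-resp es distinct es⊆X = es , refl , distinct ,
  λ e₁ e₂ e₃ e₁∈ e₂∈ e₃∈ → gp e₁ e₂ e₃ (listed⊆X e₁∈) (listed⊆X e₂∈) (listed⊆X e₃∈)
  where
  listed⊆X : ∀ {e} → Any (SameEdge e) es → X e
  listed⊆X {e} e∈ =
    let f∈X , e≈f = lookupAny es⊆X e∈ in X-resp (Any.lookup e∈) e (SameEdge-sym e (Any.lookup e∈) e≈f) f∈X

gpe-≥-2F : ∀ m → GpeAtLeast (suc (suc m)) (2 * fib (suc (suc m)))
gpe-≥-2F m = subst (GpeAtLeast (suc (suc m))) length-edges
  (GpeAtLeast-⊆ (Θ-∪-isEdgeGP first last) (∪-resp-SameEdge first last) edges edges-distinct edges-in-Θ)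
  where
  first last : Fin (suc (suc m))
  first = zero
  last  = fromℕ (suc m)
  zs : List (Vertex m)
  zs = vertices m
  edges : List (Edge (suc (suc m)))
  edges = map firstEdge zs ++ map lastEdge zs
  length-edges : length edges ≡ 2 * fib (suc (suc m))
  length-edges = begin
    length (map firstEdge zs ++ map lastEdge zs)          ≡⟨ length-++ (map firstEdge zs) ⟩
    length (map firstEdge zs) + length (map lastEdge zs)  ≡⟨ cong₂ _+_ (length-map firstEdge zs)
                                                                        (length-map lastEdge zs) ⟩
    length zs + length zs                                 ≡⟨ cong (λ k → k + k) (length-vertices m) ⟩
    fib (suc (suc m)) + fib (suc (suc m))                 ≡⟨ cong (fib (suc (suc m)) +_) (sym (+-identityʳ _)) ⟩
    2 * fib (suc (suc m))                                 ∎
    where open ≡-Reasoning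
  edges-distinct : AllPairs (λ e f → ¬ SameEdge e f) edges
  edges-distinct = AllPairs.++⁺
    (AllPairs.map⁺ (AllPairs.map (λ {u} {v} → firstEdge-distinct u v) (vertices-distinct m)))
    (AllPairs.map⁺ (AllPairs.map (λ {u} {v} → lastEdge-distinct u v) (vertices-distinct m)))
    (All.map⁺ (universal (λ u → All.map⁺ (universal (λ v →
       Θ-disjoint {i = first} {last} (firstEdge u) (lastEdge v) (λ ()) (firstEdge-Θ u) (lastEdge-Θ v)) zs)) zs))
  edges-in-Θ : All (Θ first ∪E Θ last) edges
  edges-in-Θ =
    All.++⁺ (All.map⁺ (universal (inj₁ ∘ firstEdge-Θ) zs)) (All.map⁺ (universal (inj₂ ∘ lastEdge-Θ) zs))

theorem4p3 : (m : ℕ) →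
    IsMaximalEdgeGP (Θ {suc (suc m)} zero ∪E Θ (fromℕ (suc m)))
    × GpeAtLeast (suc (suc m)) (2 * fib (suc (suc m)))
theorem4p3 m = (Θ-∪-isEdgeGP zero (fromℕ (suc m)) , Θ₁∪Θₙ-maximal m) , gpe-≥-2F m
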